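{- Let $k\ge 2$ and let $G$ be a finite graph. Let $C_{k+1}=C_{k+1}(G)$ denote the subgraph of $G$ induced by the $(k+1)$-core of $G$ (possibly empty), and let $E_k(G)$ denote the set of edges of $G$ that are not contained in $C_{k+1}$. Then $$r_k(G)=|E_k(G)|+r_k(C_{k+1}).$$
   Context: The $\kappa$-core of a graph is the largest set of vertices inducing a subgraph of minimum degree at least $\kappa$. For a graph $H$, $r_k(H)$ denotes the rank of $E(H)$ in the matroid that is the union of $k$ copies of the cycle matroid, i.e. the maximum total number of edges of $k$ edge-disjoint forests contained in $H$. -}

module Defs where

open import Data.Nat using (ℕ; zero; suc; _+_; _≤_; _<ᵇ_)
open import Data.Bool using (Bool; true; false; _∧_; not; if_then_else_)
open import Data.Fin using (Fin; toℕ)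
open import Data.List using (List; []; _∷_; _++_; [_]; length; map; allFin)
open import Data.Nat.ListAction using (sum)
open import Data.List.Relation.Unary.Linked using (Linked)
open import Data.List.Relation.Unary.Unique.Propositional using (Unique)
open import Data.Product using (Σ; _×_; ∃; ∃-syntax)
open import Relation.Binary.PropositionalEquality using (_≡_; _≢_)

record Graph (n : ℕ) : Set where
  field
    adj    : Fin n → Fin n → Bool
    sym    : ∀ i j → adj i j ≡ adj j i
    irrefl : ∀ i → adj i i ≡ false
open Graph public

EdgeSet : ℕ → Set
EdgeSet n = Fin n → Fin n → Bool

Symmetric : ∀ {n} → EdgeSet n → Set
Symmetric e = ∀ i j → e i j ≡ e j i

count : ∀ {n} → (Fin n → Bool) → ℕ
count {n} p = sum (map (λ i → if p i then 1 else 0) (allFin n))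

numEdges : ∀ {n} → EdgeSet n → ℕ
numEdges {n} e = sum (map (λ i → count (λ j → (toℕ i <ᵇ toℕ j) ∧ e i j)) (allFin n))

HasCycle : ∀ {n} → EdgeSet n → Set
HasCycle {n} e =
  Σ (Fin n) λ v → Σ (List (Fin n)) λ ws →
    (2 ≤ length ws) × Unique (v ∷ ws) ×
    Linked (λ a b → e a b ≡ true) (v ∷ ws ++ [ v ])

IsForest : ∀ {n} → EdgeSet n → Set
IsForest e = HasCycle e → Data.Empty.⊥
  where import Data.Empty

record DisjointForests {n} (k : ℕ) (h : EdgeSet n) : Set where
  field
    forest   : Fin k → EdgeSet n
    fsym     : ∀ a → Symmetric (forest a)
    acyclic  : ∀ a → IsForest (forest a)
    inside   : ∀ a i j → forest a i j ≡ true → h i j ≡ true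
    disjoint : ∀ a b i j → a ≢ b → forest a i j ≡ true → forest b i j ≡ false
open DisjointForests public

totalEdges : ∀ {n k} {h : EdgeSet n} → DisjointForests k h → ℕ
totalEdges {k = k} F = sum (map (λ a → numEdges (forest F a)) (allFin k))

-- r_k(h) ≡ r : r is the maximum total number of edges of k edge-disjoint
-- forests contained in h (rank of h in the union of k cycle matroids).
IsRank : ∀ {n} → ℕ → EdgeSet n → ℕ → Set
IsRank k h r =
  (Σ (DisjointForests k h) λ F → totalEdges F ≡ r) ×
  (∀ (F : DisjointForests k h) → totalEdges F ≤ r)

VSet : ℕ → Set
VSet n = Fin n → Bool

-- induced subgraph on S (kept on vertex set Fin n; vertices outside S isolated)
induced : ∀ {n} → Graph n → VSet n → EdgeSet n
induced G S i j = S i ∧ S j ∧ adj G i j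

MinDegInduced : ∀ {n} → ℕ → Graph n → VSet n → Set
MinDegInduced κ G S = ∀ v → S v ≡ true → κ ≤ count (λ u → induced G S v u)

_⊆ᵥ_ : ∀ {n} → VSet n → VSet n → Set
T ⊆ᵥ S = ∀ v → T v ≡ true → S v ≡ true

IsCore : ∀ {n} → ℕ → Graph n → VSet n → Set
IsCore κ G S = MinDegInduced κ G S × (∀ T → MinDegInduced κ G T → T ⊆ᵥ S)

outsideEdges : ∀ {n} → Graph n → VSet n → EdgeSet n
outsideEdges G S i j = adj G i j ∧ not (S i ∧ S j)

-- Cutting every forest of a family in G along the edge set
-- inside S gives a family of forests in G[S] (at most r_k(G[S]) edges) and
-- a family of pairwise disjoint edge sets outside S (at most |E_k| edges).
--
-- Start from an optimal family in G[S] and add back the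
-- vertices outside S one at a time.  As long as the current vertex set U
-- strictly contains S it is not of minimum degree k+1 (S is the largest such
-- set), so some vertex v ∈ U has at most k neighbours in G[U], and v ∉ S.
-- Recursively extend the family to U - v, then put the ≤ k edges at v into
-- pairwise different forests; v is a leaf of each forest, so no cycle is
-- created.  The family obtained for U = V(G) uses all of E_k.
module Submission where

open import Defs
open import Data.Nat using (ℕ; _≤_; _+_; suc)
open import Relation.Binary.PropositionalEquality using (_≡_)

open import Level using (0ℓ)
open import Function using (_∘_; id; Equivalence)
open import Data.Empty using (⊥)
open import Data.Unit using (tt)
open import Data.Bool using (Bool; true; false; _∧_; _∨_; not; T; if_then_else_)
open import Data.Bool.Properties
  using (∧-comm; ∧-assoc; ∧-zeroʳ; ∧-identityʳ; ∨-identityʳ; ∨-comm;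
         ∧-conicalˡ; ∧-conicalʳ; ¬-not; not-involutive; T-≡)
  renaming (_≟_ to _≟ᵇ_)
open import Data.Nat using (zero; _<_; _≤?_; _<ᵇ_; _≡ᵇ_; z≤n; s≤s; s≤s⁻¹)
open import Data.Nat.Properties
  using (≤-refl; ≤-reflexive; ≤-trans; ≤-antisym; <-irrefl; <-trans; <-cmp; <⇒≢;
         +-comm; +-mono-≤; +-mono-<-≤; +-mono-≤-<; m≤m+n; m≤n+m; ≰⇒>;
         <ᵇ⇒<; <⇒<ᵇ; ≡ᵇ⇒≡; ≡⇒≡ᵇ; +-0-commutativeMonoid)
open import Data.Nat.Induction using (<-wellFounded)
open Data.Nat.Properties using (module ≤-Reasoning)
import Data.Nat.ListAction as List
open import Data.Fin using (Fin; toℕ; fromℕ<; _≟_)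
import Data.Fin as Fin
open import Data.Fin.Properties using (toℕ-injective; toℕ-fromℕ<; suc-injective; all?; ¬∀⟶∃¬)
open import Data.List using (List; []; _∷_; _++_; [_]; length; map; allFin; tabulate)
open import Data.List.Properties using (map-tabulate; length-++; ++-assoc)
open import Data.List.Relation.Unary.All as All using (All; []; _∷_)
import Data.List.Relation.Unary.All.Properties as All
open import Data.List.Relation.Unary.AllPairs using ([]; _∷_)
open import Data.List.Relation.Unary.Any using (here; there; any?)
open import Data.List.Relation.Unary.Linked as Linked using (Linked; []; [-]; _∷_)
open import Data.List.Relation.Unary.Unique.Propositional using (Unique)
import Data.List.Relation.Unary.Unique.Propositional.Properties as Unique
open import Data.List.Membership.Propositional using (_∈_; _∉_)
open import Data.List.Membership.Propositional.Properties using (∈-∃++)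
open import Data.Product using (Σ; _×_; _,_; proj₁; proj₂; ∃; ∃₂)
open import Relation.Nullary using (¬_; Dec; yes; no; does; contradiction)
open import Relation.Binary using (tri<; tri≈; tri>)
open import Relation.Nullary.Decidable using (dec-true; dec-false; _→-dec_; decidable-stable)
open import Relation.Binary.PropositionalEquality
  using (_≢_; refl; trans; cong; cong₂; subst; subst₂; ≢-sym; module ≡-Reasoning)
import Relation.Binary.PropositionalEquality as ≡
import Relation.Binary.Construct.On as On
open import Induction.WellFounded using (module All)
open import Algebra.Properties.CommutativeMonoid.Sum +-0-commutativeMonoid
  using (sum; sum-syntax; sum-cong-≗; sum-replicate-zero; ∑-comm; ∑-distrib-+)

ind : Bool → ℕ
ind b = if b then 1 else 0

∧-intro : ∀ {x y} → x ≡ true → y ≡ true → x ∧ y ≡ true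
∧-intro refl refl = refl

not-true : ∀ {x} → not x ≡ true → x ≡ false
not-true {x} e = trans (≡.sym (not-involutive x)) (cong not e)

true≢false : true ≢ false
true≢false ()

sum-allFin : ∀ {n} (g : Fin n → ℕ) → List.sum (map g (allFin n)) ≡ ∑[ i < n ] g i
sum-allFin g = trans (cong List.sum (map-tabulate id g)) (sum-tabulate g)
  where
  sum-tabulate : ∀ {m} (f : Fin m → ℕ) → List.sum (tabulate f) ≡ ∑[ i < m ] f i
  sum-tabulate {zero}  f = refl
  sum-tabulate {suc m} f = cong (f Fin.zero +_) (sum-tabulate (f ∘ Fin.suc))

∑-mono : ∀ {n} {f g : Fin n → ℕ} → (∀ i → f i ≤ g i) → ∑[ i < n ] f i ≤ ∑[ i < n ] g i
∑-mono {zero}  f≤g = z≤n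
∑-mono {suc n} f≤g = +-mono-≤ (f≤g Fin.zero) (∑-mono (f≤g ∘ Fin.suc))

∑-mono-< : ∀ {n} {f g : Fin n → ℕ} → (∀ i → f i ≤ g i) → ∀ v → f v < g v →
  ∑[ i < n ] f i < ∑[ i < n ] g i
∑-mono-< f≤g Fin.zero    fv<gv = +-mono-<-≤ fv<gv (∑-mono (f≤g ∘ Fin.suc))
∑-mono-< f≤g (Fin.suc v) fv<gv = +-mono-≤-< (f≤g Fin.zero) (∑-mono-< (f≤g ∘ Fin.suc) v fv<gv)

∑-term : ∀ {n} (f : Fin n → ℕ) i → f i ≤ ∑[ i < n ] f i
∑-term f Fin.zero    = m≤m+n _ _
∑-term f (Fin.suc i) = ≤-trans (∑-term (f ∘ Fin.suc) i) (m≤n+m _ _)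

count-∑ : ∀ {n} (p : Fin n → Bool) → count p ≡ ∑[ i < n ] ind (p i)
count-∑ p = sum-allFin (λ i → ind (p i))

ind-mono : ∀ {a b} → (a ≡ true → b ≡ true) → ind a ≤ ind b
ind-mono {false} a⇒b = z≤n
ind-mono {true}  a⇒b rewrite a⇒b refl = ≤-refl

count-mono : ∀ {n} {p q : Fin n → Bool} → (∀ i → p i ≡ true → q i ≡ true) → count p ≤ count q
count-mono {p = p} {q} p⊆q =
  subst₂ _≤_ (≡.sym (count-∑ p)) (≡.sym (count-∑ q)) (∑-mono (λ i → ind-mono (p⊆q i)))

count-mono-< : ∀ {n} {p q : Fin n → Bool} → (∀ i → p i ≡ true → q i ≡ true) →
  ∀ v → p v ≡ false → q v ≡ true → count p < count q
count-mono-< {p = p} {q} p⊆q v pv qv =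
  subst₂ _<_ (≡.sym (count-∑ p)) (≡.sym (count-∑ q))
    (∑-mono-< (λ i → ind-mono (p⊆q i)) v ind-pv<ind-qv)
  where
  ind-pv<ind-qv : ind (p v) < ind (q v)
  ind-pv<ind-qv = subst₂ (λ a b → ind a < ind b) (≡.sym pv) (≡.sym qv) ≤-refl

Exclusive : ∀ {k} → (Fin k → Bool) → Set
Exclusive g = ∀ a b → a ≢ b → g a ≡ true → g b ≡ false

∑-ind-none : ∀ {k} (g : Fin k → Bool) → (∀ a → g a ≡ false) → ∑[ a < k ] ind (g a) ≡ 0
∑-ind-none {zero}  g none = refl
∑-ind-none {suc k} g none rewrite none Fin.zero = ∑-ind-none (g ∘ Fin.suc) (none ∘ Fin.suc)

∑-ind-exclusive : ∀ {k} (g : Fin k → Bool) → Exclusive g → ∑[ a < k ] ind (g a) ≤ 1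
∑-ind-exclusive {zero}  g excl = z≤n
∑-ind-exclusive {suc k} g excl with g Fin.zero in g₀
... | true  = ≤-reflexive (cong suc (∑-ind-none (g ∘ Fin.suc) rest-false))
  where
  rest-false : ∀ a → g (Fin.suc a) ≡ false
  rest-false a = excl Fin.zero (Fin.suc a) (λ ()) g₀
... | false =
  ∑-ind-exclusive (g ∘ Fin.suc) (λ a b a≢b → excl (Fin.suc a) (Fin.suc b) (a≢b ∘ suc-injective))

∑-ind-bounded : ∀ {k} (g : Fin k → Bool) c → Exclusive g → (∀ a → g a ≡ true → c ≡ true) →
  ∑[ a < k ] ind (g a) ≤ ind c
∑-ind-bounded g true  excl g⇒c = ∑-ind-exclusive g excl
∑-ind-bounded g false excl g⇒c =
  ≤-reflexive (∑-ind-none g (λ a → ¬-not (λ ga → contradiction (g⇒c a ga) λ ())))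

∑-ind-exact : ∀ {k} (g : Fin k → Bool) c → Exclusive g → (∀ a → g a ≡ true → c ≡ true) →
  (c ≡ true → ∃ λ a → g a ≡ true) → ∑[ a < k ] ind (g a) ≡ ind c
∑-ind-exact g false excl g⇒c c⇒g = ≤-antisym (∑-ind-bounded g false excl g⇒c) z≤n
∑-ind-exact g true  excl g⇒c c⇒g with c⇒g refl
... | a , ga = ≤-antisym (∑-ind-exclusive g excl)
                 (subst (λ b → ind b ≤ ∑[ a < _ ] ind (g a)) ga (∑-term (λ a → ind (g a)) a))

infixr 7 _∩_
infix 4 _⊆ₑ_

_∩_ : ∀ {n} → EdgeSet n → EdgeSet n → EdgeSet n
(e ∩ b) i j = e i j ∧ b i j

∁ : ∀ {n} → EdgeSet n → EdgeSet n
∁ b i j = not (b i j)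

_⊆ₑ_ : ∀ {n} → EdgeSet n → EdgeSet n → Set
e ⊆ₑ h = ∀ i j → e i j ≡ true → h i j ≡ true

∩-sym : ∀ {n} {e b : EdgeSet n} → Symmetric e → Symmetric b → Symmetric (e ∩ b)
∩-sym e-sym b-sym i j = cong₂ _∧_ (e-sym i j) (b-sym i j)

∁-sym : ∀ {n} {b : EdgeSet n} → Symmetric b → Symmetric (∁ b)
∁-sym b-sym i j = cong not (b-sym i j)

below : ∀ {n} → Fin n → Fin n → Bool
below i j = toℕ i <ᵇ toℕ j

edgeInd : ∀ {n} → EdgeSet n → Fin n → Fin n → ℕ
edgeInd e i j = ind (below i j ∧ e i j)

numEdges-∑ : ∀ {n} (e : EdgeSet n) → numEdges e ≡ ∑[ i < n ] ∑[ j < n ] edgeInd e i j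
numEdges-∑ e = trans (sum-allFin (λ i → count (λ j → below i j ∧ e i j)))
  (sum-cong-≗ (λ i → count-∑ (λ j → below i j ∧ e i j)))

numEdges-cong : ∀ {n} {e e′ : EdgeSet n} → (∀ i j → e i j ≡ e′ i j) → numEdges e ≡ numEdges e′
numEdges-cong {e = e} {e′} e≗e′ = begin
  numEdges e                           ≡⟨ numEdges-∑ e ⟩
  ∑[ i < _ ] ∑[ j < _ ] edgeInd e i j  ≡⟨ sum-cong-≗ (λ i → sum-cong-≗ (λ j → same-pair i j)) ⟩
  ∑[ i < _ ] ∑[ j < _ ] edgeInd e′ i j ≡⟨ numEdges-∑ e′ ⟨
  numEdges e′                          ∎
  where
  open ≡-Reasoning
  same-pair : ∀ i j → edgeInd e i j ≡ edgeInd e′ i j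
  same-pair i j = cong (λ b → ind (below i j ∧ b)) (e≗e′ i j)

numEdges-split : ∀ {n} (e b : EdgeSet n) → numEdges e ≡ numEdges (e ∩ b) + numEdges (e ∩ ∁ b)
numEdges-split {n} e b = begin
  numEdges e
    ≡⟨ numEdges-∑ e ⟩
  ∑[ i < n ] ∑[ j < n ] edgeInd e i j
    ≡⟨ sum-cong-≗ (λ i → sum-cong-≗ (λ j → ind-split (below i j) (e i j) (b i j))) ⟩
  ∑[ i < n ] ∑[ j < n ] (inside-b i j + outside-b i j)
    ≡⟨ sum-cong-≗ (λ i → ∑-distrib-+ (inside-b i) (outside-b i)) ⟩
  ∑[ i < n ] (∑[ j < n ] inside-b i j + ∑[ j < n ] outside-b i j)
    ≡⟨ ∑-distrib-+ (λ i → ∑[ j < n ] inside-b i j) (λ i → ∑[ j < n ] outside-b i j) ⟩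
  ∑[ i < n ] ∑[ j < n ] inside-b i j + ∑[ i < n ] ∑[ j < n ] outside-b i j
    ≡⟨ cong₂ _+_ (numEdges-∑ (e ∩ b)) (numEdges-∑ (e ∩ ∁ b)) ⟨
  numEdges (e ∩ b) + numEdges (e ∩ ∁ b)
    ∎
  where
  open ≡-Reasoning
  inside-b outside-b : Fin n → Fin n → ℕ
  inside-b  = edgeInd (e ∩ b)
  outside-b = edgeInd (e ∩ ∁ b)
  ind-split : ∀ l x c → ind (l ∧ x) ≡ ind (l ∧ (x ∧ c)) + ind (l ∧ (x ∧ not c))
  ind-split false x     c     = refl
  ind-split true  false c     = refl
  ind-split true  true  false = refl
  ind-split true  true  true  = refl

∑-numEdges : ∀ {n k} (f : Fin k → EdgeSet n) →
  ∑[ a < k ] numEdges (f a) ≡ ∑[ i < n ] ∑[ j < n ] ∑[ a < k ] edgeInd (f a) i j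
∑-numEdges {n} {k} f = begin
  ∑[ a < k ] numEdges (f a)
    ≡⟨ sum-cong-≗ (λ a → numEdges-∑ (f a)) ⟩
  ∑[ a < k ] ∑[ i < n ] ∑[ j < n ] edgeInd (f a) i j
    ≡⟨ ∑-comm (λ a i → ∑[ j < n ] edgeInd (f a) i j) ⟩
  ∑[ i < n ] ∑[ a < k ] ∑[ j < n ] edgeInd (f a) i j
    ≡⟨ sum-cong-≗ (λ i → ∑-comm (λ a j → edgeInd (f a) i j)) ⟩
  ∑[ i < n ] ∑[ j < n ] ∑[ a < k ] edgeInd (f a) i j
    ∎
  where open ≡-Reasoning

module _ {n k : ℕ} (f : Fin k → EdgeSet n) (h : EdgeSet n)
         (exclusive : ∀ i j → Exclusive (λ a → f a i j)) (inside-h : ∀ a → f a ⊆ₑ h) where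

  private
    pair-≤ : ∀ l i j → ∑[ a < k ] ind (l ∧ f a i j) ≤ ind (l ∧ h i j)
    pair-≤ false i j = ≤-reflexive (sum-replicate-zero k)
    pair-≤ true  i j = ∑-ind-bounded (λ a → f a i j) (h i j) (exclusive i j) (λ a → inside-h a i j)

    pair-≡ : (∀ i j → h i j ≡ true → ∃ λ a → f a i j ≡ true) →
      ∀ l i j → ∑[ a < k ] ind (l ∧ f a i j) ≡ ind (l ∧ h i j)
    pair-≡ covers false i j = sum-replicate-zero k
    pair-≡ covers true  i j = ∑-ind-exact (λ a → f a i j) (h i j) (exclusive i j) (λ a → inside-h a i j)
                                (covers i j)

  ∑-numEdges-≤ : ∑[ a < k ] numEdges (f a) ≤ numEdges h
  ∑-numEdges-≤ = subst₂ _≤_ (≡.sym (∑-numEdges f)) (≡.sym (numEdges-∑ h))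
    (∑-mono (λ i → ∑-mono (λ j → pair-≤ (below i j) i j)))

  ∑-numEdges-≡ : (∀ i j → h i j ≡ true → ∃ λ a → f a i j ≡ true) →
    ∑[ a < k ] numEdges (f a) ≡ numEdges h
  ∑-numEdges-≡ covers = trans (∑-numEdges f)
    (trans (sum-cong-≗ (λ i → sum-cong-≗ (λ j → pair-≡ covers (below i j) i j)))
           (≡.sym (numEdges-∑ h)))

forest-mono : ∀ {n} {e f : EdgeSet n} → e ⊆ₑ f → IsForest f → IsForest e
forest-mono e⊆f f-forest (v , ws , long , distinct , path) =
  f-forest (v , ws , long , distinct , Linked.map (λ {a} {b} → e⊆f a b) path)

module _ {n k : ℕ} where

  weaken : ∀ {h h′ : EdgeSet n} → h ⊆ₑ h′ → DisjointForests k h → DisjointForests k h′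
  weaken h⊆h′ F = record
    { forest = forest F ; fsym = fsym F ; acyclic = acyclic F
    ; inside = λ a i j e → h⊆h′ i j (inside F a i j e) ; disjoint = disjoint F }

  restrict : ∀ {h : EdgeSet n} → DisjointForests k h → (b : EdgeSet n) → Symmetric b →
    DisjointForests k (h ∩ b)
  restrict F b b-sym = record
    { forest   = λ a → forest F a ∩ b
    ; fsym     = λ a → ∩-sym (fsym F a) b-sym
    ; acyclic  = λ a → forest-mono (λ i j → ∧-conicalˡ _ _) (acyclic F a)
    ; inside   = λ a i j e → ∧-intro (inside F a i j (∧-conicalˡ _ _ e)) (∧-conicalʳ _ _ e)
    ; disjoint = λ a c i j a≢c e → cong (_∧ b i j) (disjoint F a c i j a≢c (∧-conicalˡ _ _ e)) }

  totalEdges-∑ : ∀ {h : EdgeSet n} (F : DisjointForests k h) →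
    totalEdges F ≡ ∑[ a < k ] numEdges (forest F a)
  totalEdges-∑ F = sum-allFin (λ a → numEdges (forest F a))

  totalEdges-≤ : ∀ {h : EdgeSet n} (F : DisjointForests k h) → totalEdges F ≤ numEdges h
  totalEdges-≤ {h} F = subst (_≤ numEdges h) (≡.sym (totalEdges-∑ F))
    (∑-numEdges-≤ (forest F) h (λ i j a b a≢b → disjoint F a b i j a≢b) (inside F))

  totalEdges-≡ : ∀ {h : EdgeSet n} (F : DisjointForests k h) →
    (∀ i j → h i j ≡ true → ∃ λ a → forest F a i j ≡ true) → totalEdges F ≡ numEdges h
  totalEdges-≡ {h} F covers = trans (totalEdges-∑ F)
    (∑-numEdges-≡ (forest F) h (λ i j a b a≢b → disjoint F a b i j a≢b) (inside F) covers)

  totalEdges-cong : ∀ {h h′ : EdgeSet n} (F : DisjointForests k h) (F′ : DisjointForests k h′) →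
    (∀ a i j → forest F a i j ≡ forest F′ a i j) → totalEdges F ≡ totalEdges F′
  totalEdges-cong F F′ same = trans (totalEdges-∑ F)
    (trans (sum-cong-≗ (λ a → numEdges-cong (same a))) (≡.sym (totalEdges-∑ F′)))

  totalEdges-split : ∀ {h : EdgeSet n} (F : DisjointForests k h) (b : EdgeSet n)
    (b-sym : Symmetric b) →
    totalEdges F ≡ totalEdges (restrict F b b-sym) + totalEdges (restrict F (∁ b) (∁-sym b-sym))
  totalEdges-split {h} F b b-sym = begin
    totalEdges F
      ≡⟨ totalEdges-∑ F ⟩
    ∑[ a < k ] numEdges (forest F a)
      ≡⟨ sum-cong-≗ (λ a → numEdges-split (forest F a) b) ⟩
    ∑[ a < k ] (numEdges (forest F a ∩ b) + numEdges (forest F a ∩ ∁ b))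
      ≡⟨ ∑-distrib-+ (λ a → numEdges (forest F a ∩ b)) (λ a → numEdges (forest F a ∩ ∁ b)) ⟩
    ∑[ a < k ] numEdges (forest F a ∩ b) + ∑[ a < k ] numEdges (forest F a ∩ ∁ b)
      ≡⟨ cong₂ _+_ (totalEdges-∑ inner) (totalEdges-∑ outer) ⟨
    totalEdges inner + totalEdges outer
      ∎
    where
    open ≡-Reasoning
    inner : DisjointForests k (h ∩ b)
    inner = restrict F b b-sym
    outer : DisjointForests k (h ∩ ∁ b)
    outer = restrict F (∁ b) (∁-sym b-sym)

-- This is the shape used in HasCycle, so that
-- HasCycle e is Σ v Σ ws (Cycle (λ a b → e a b ≡ true) v ws).
Cycle : ∀ {A : Set} → (A → A → Set) → A → List A → Set
Cycle R v ws = (2 ≤ length ws) × Unique (v ∷ ws) × Linked R (v ∷ ws ++ [ v ])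

module _ {A : Set} {R : A → A → Set} where

  lastOf : A → List A → A
  lastOf x []        = x
  lastOf x (y ∷ xs) = lastOf y xs

  lastOf-∈ : ∀ x xs → lastOf x xs ∈ x ∷ xs
  lastOf-∈ x []       = here refl
  lastOf-∈ x (y ∷ xs) = there (lastOf-∈ y xs)

  linked-end : ∀ x xs {z} → Linked R (x ∷ xs ++ [ z ]) → R (lastOf x xs) z
  linked-end x []       (r ∷ [-]) = r
  linked-end x (y ∷ xs) (_ ∷ rs) = linked-end y xs rs

  linked-snoc : ∀ x xs {y z} → Linked R (x ∷ xs ++ [ y ]) → R y z →
    Linked R (x ∷ (xs ++ [ y ]) ++ [ z ])
  linked-snoc x []       (r ∷ [-]) r′ = r ∷ r′ ∷ [-]
  linked-snoc x (y ∷ xs) (r ∷ rs)  r′ = r ∷ linked-snoc y xs rs r′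

  rotate : ∀ {v w ws} → Cycle R v (w ∷ ws) → Cycle R w (ws ++ [ v ])
  rotate {v} {w} {ws} (long , distinct@(_ ∷ distinct′) , r ∷ path) =
    long′ , Unique.++⁺ distinct′ ([] ∷ []) v-new , linked-snoc w ws path r
    where
    long′ : 2 ≤ length (ws ++ [ v ])
    long′ = subst (2 ≤_) (≡.sym (trans (length-++ ws) (+-comm (length ws) 1))) long
    v-new : ∀ {x} → x ∈ w ∷ ws × x ∈ [ v ] → ⊥
    v-new (x∈ , here refl) = Unique.Unique[x∷xs]⇒x∉xs distinct x∈

  rotate-to : ∀ {v} pre {x} post → Cycle R v (pre ++ x ∷ post) → ∃ λ ws → Cycle R x ws
  rotate-to         []        post c = _ , rotate c
  rotate-to {v} (p ∷ pre) {x} post c =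
    rotate-to pre (post ++ [ v ]) (subst (Cycle R p) (++-assoc pre (x ∷ post) [ v ]) (rotate c))

  cycle-from : ∀ {x v ws} → x ∈ v ∷ ws → Cycle R v ws → ∃ λ ws′ → Cycle R x ws′
  cycle-from (here refl) c = _ , c
  cycle-from (there x∈ws) c with ∈-∃++ x∈ws
  ... | pre , post , refl = rotate-to pre post c

  cycle-branches : (∀ {a b} → R a b → R b a) → ∀ {x ws} → Cycle R x ws →
    ∃₂ λ y z → y ≢ z × R x y × R x z
  cycle-branches R-sym {ws = []}    (() , _)
  cycle-branches R-sym {ws = _ ∷ []} (s≤s () , _)
  cycle-branches R-sym {x} {w₁ ∷ w₂ ∷ ws} (_ , (_ ∷ w₁-new ∷ _) , path@(r ∷ _)) =
    w₁ , lastOf w₂ ws , All.lookup w₁-new (lastOf-∈ w₂ ws) ,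
    r , R-sym (linked-end x (w₁ ∷ w₂ ∷ ws) path)

  leaf-off-cycles : (∀ {a b} → R a b → R b a) → ∀ {x} → (∀ {y z} → R x y → R x z → y ≡ z) →
    ∀ {v ws} → x ∈ v ∷ ws → ¬ Cycle R v ws
  leaf-off-cycles R-sym leaf x∈ c with cycle-branches R-sym (proj₂ (cycle-from x∈ c))
  ... | y , z , y≢z , xy , xz = y≢z (leaf xy xz)

cycle-avoiding : ∀ {A : Set} {R R′ : A → A → Set} {x} →
  (∀ {a b} → x ≢ a → x ≢ b → R a b → R′ a b) →
  ∀ {v ws} → x ∉ v ∷ ws → Cycle R v ws → Cycle R′ v ws
cycle-avoiding {R = R} {R′} {x} R⇒R′ {v} {ws} x∉ (long , distinct , path) =
  long , distinct , transfer (All.++⁺ avoid (All.head avoid ∷ [])) path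
  where
  avoid : All (x ≢_) (v ∷ ws)
  avoid = All.¬Any⇒All¬ (v ∷ ws) x∉
  transfer : ∀ {l} → All (x ≢_) l → Linked R l → Linked R′ l
  transfer []                    []         = []
  transfer (_ ∷ [])              [-]        = [-]
  transfer (xa ∷ avoid′@(xb ∷ _)) (r ∷ rs) = R⇒R′ xa xb r ∷ transfer avoid′ rs

leaf-extension : ∀ {n} {e e′ : EdgeSet n} (v : Fin n) → Symmetric e′ →
  (∀ i j → i ≢ v → j ≢ v → e′ i j ≡ e i j) →
  (∀ y z → e′ v y ≡ true → e′ v z ≡ true → y ≡ z) → IsForest e → IsForest e′
leaf-extension {e = e} {e′} v e′-sym away leaf e-forest (u , ws , c) with any? (v ≟_) (u ∷ ws)
... | yes v∈ = leaf-off-cycles (λ {a} {b} r → trans (e′-sym b a) r) (leaf _ _) v∈ c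
... | no v∉  = e-forest (u , ws , cycle-avoiding same-edge v∉ c)
  where
  same-edge : ∀ {a b} → v ≢ a → v ≢ b → e′ a b ≡ true → e a b ≡ true
  same-edge {a} {b} v≢a v≢b = trans (≡.sym (away a b (≢-sym v≢a) (≢-sym v≢b)))

below⇒< : ∀ {n} {i j : Fin n} → below i j ≡ true → toℕ i < toℕ j
below⇒< {i = i} {j} e = <ᵇ⇒< (toℕ i) (toℕ j) (subst T (≡.sym e) tt)

<⇒below : ∀ {n} {i j : Fin n} → toℕ i < toℕ j → below i j ≡ true
<⇒below lt = Equivalence.to T-≡ (<⇒<ᵇ lt)

below-irrefl : ∀ {n} (u : Fin n) → below u u ≡ false
below-irrefl u = ¬-not (λ e → <-irrefl refl (below⇒< {i = u} {u} e))

rank : ∀ {n} → VSet n → Fin n → ℕ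
rank p u = count (λ w → below w u ∧ p w)

rank<count : ∀ {n} (p : VSet n) {u} → p u ≡ true → rank p u < count p
rank<count p {u} pu =
  count-mono-< (λ w → ∧-conicalʳ _ _) u (cong (_∧ p u) (below-irrefl u)) pu

rank-increasing : ∀ {n} (p : VSet n) {x y} → p x ≡ true → toℕ x < toℕ y → rank p x < rank p y
rank-increasing p {x} {y} px x<y =
  count-mono-< lift x (cong (_∧ p x) (below-irrefl x)) (∧-intro (<⇒below x<y) px)
  where
  lift : ∀ w → below w x ∧ p w ≡ true → below w y ∧ p w ≡ true
  lift w e = ∧-intro (<⇒below (<-trans (below⇒< (∧-conicalˡ _ _ e)) x<y)) (∧-conicalʳ _ _ e)

rank-injective : ∀ {n} (p : VSet n) {x y} → p x ≡ true → p y ≡ true → rank p x ≡ rank p y → x ≡ y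
rank-injective p {x} {y} px py same with <-cmp (toℕ x) (toℕ y)
... | tri< x<y _ _ = contradiction same (<⇒≢ (rank-increasing p px x<y))
... | tri≈ _ x≡y _ = toℕ-injective x≡y
... | tri> _ _ y<x = contradiction (≡.sym same) (<⇒≢ (rank-increasing p py y<x))

-- Putting the edge v j into forest number rank N j gives a family
-- in h that agrees with F₀ away from v and contains every edge v j, j ∈ N.
module Attach {n k : ℕ} {h₀ h : EdgeSet n} (F₀ : DisjointForests k h₀)
  (v : Fin n) (N : VSet n) (N≤k : count N ≤ k) (v∉N : N v ≡ false)
  (v-isolated : ∀ j → h₀ v j ≡ false) (h₀⊆h : h₀ ⊆ₑ h)
  (N⊆h : ∀ j → N j ≡ true → h v j ≡ true) (h-sym : Symmetric h) where

  isV : Fin n → Bool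
  isV u = does (u ≟ v)

  slot : Fin k → Fin n → Bool
  slot a j = N j ∧ (toℕ a ≡ᵇ rank N j)

  slot⇒N : ∀ a j → slot a j ≡ true → N j ≡ true
  slot⇒N a j = ∧-conicalˡ (N j) _

  slot⇒rank : ∀ a j → slot a j ≡ true → toℕ a ≡ rank N j
  slot⇒rank a j e = ≡ᵇ⇒≡ (toℕ a) (rank N j) (Equivalence.from T-≡ (∧-conicalʳ (N j) _ e))

  slot-exclusive : ∀ a b j → a ≢ b → slot a j ≡ true → slot b j ≡ false
  slot-exclusive a b j a≢b sa =
    ¬-not (λ sb → a≢b (toℕ-injective (trans (slot⇒rank a j sa) (≡.sym (slot⇒rank b j sb)))))

  slot-leaf : ∀ a y z → slot a y ≡ true → slot a z ≡ true → y ≡ z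
  slot-leaf a y z sy sz =
    rank-injective N (slot⇒N a y sy) (slot⇒N a z sz)
      (trans (≡.sym (slot⇒rank a y sy)) (slot⇒rank a z sz))

  slot-exists : ∀ {j} → N j ≡ true → ∃ λ a → slot a j ≡ true
  slot-exists {j} Nj =
    fromℕ< rank<k , ∧-intro Nj (Equivalence.to T-≡ (≡⇒≡ᵇ _ _ (toℕ-fromℕ< rank<k)))
    where
    rank<k : rank N j < k
    rank<k = ≤-trans (rank<count N Nj) N≤k

  grown : Fin k → EdgeSet n
  grown a i j = forest F₀ a i j ∨ (isV i ∧ slot a j) ∨ (isV j ∧ slot a i)

  F₀-at-v : ∀ a j → forest F₀ a v j ≡ false
  F₀-at-v a j = ¬-not (λ e → true≢false (trans (≡.sym (inside F₀ a v j e)) (v-isolated j)))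

  grown-sym : ∀ a → Symmetric (grown a)
  grown-sym a i j = begin
    forest F₀ a i j ∨ (isV i ∧ slot a j) ∨ (isV j ∧ slot a i)
      ≡⟨ cong (_∨ (isV i ∧ slot a j) ∨ (isV j ∧ slot a i)) (fsym F₀ a i j) ⟩
    forest F₀ a j i ∨ (isV i ∧ slot a j) ∨ (isV j ∧ slot a i)
      ≡⟨ cong (forest F₀ a j i ∨_) (∨-comm (isV i ∧ slot a j) (isV j ∧ slot a i)) ⟩
    forest F₀ a j i ∨ (isV j ∧ slot a i) ∨ (isV i ∧ slot a j) ∎
    where open ≡-Reasoning

  grown-at-v : ∀ a j → grown a v j ≡ slot a j
  grown-at-v a j rewrite F₀-at-v a j | dec-true (v ≟ v) refl | v∉N | ∧-zeroʳ (isV j) =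
    ∨-identityʳ (slot a j)

  grown-at-v′ : ∀ a i → grown a i v ≡ slot a i
  grown-at-v′ a i = trans (grown-sym a i v) (grown-at-v a i)

  grown-away : ∀ a i j → i ≢ v → j ≢ v → grown a i j ≡ forest F₀ a i j
  grown-away a i j i≢v j≢v rewrite dec-false (i ≟ v) i≢v | dec-false (j ≟ v) j≢v =
    ∨-identityʳ (forest F₀ a i j)

  data Position (i j : Fin n) : Set where
    starts-at-v : i ≡ v → Position i j
    ends-at-v   : j ≡ v → Position i j
    avoids-v    : i ≢ v → j ≢ v → Position i j

  position : ∀ i j → Position i j
  position i j with i ≟ v | j ≟ v
  ... | yes i≡v | _       = starts-at-v i≡v
  ... | no _    | yes j≡v = ends-at-v j≡v
  ... | no i≢v  | no j≢v  = avoids-v i≢v j≢v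

  grown-inside : ∀ a → grown a ⊆ₑ h
  grown-inside a i j e with position i j
  ... | starts-at-v refl = N⊆h j (slot⇒N a j (trans (≡.sym (grown-at-v a j)) e))
  ... | ends-at-v refl   = trans (h-sym i v) (N⊆h i (slot⇒N a i (trans (≡.sym (grown-at-v′ a i)) e)))
  ... | avoids-v i≢v j≢v = h₀⊆h i j (inside F₀ a i j (trans (≡.sym (grown-away a i j i≢v j≢v)) e))

  grown-disjoint : ∀ a b i j → a ≢ b → grown a i j ≡ true → grown b i j ≡ false
  grown-disjoint a b i j a≢b e with position i j
  ... | starts-at-v refl =
    trans (grown-at-v b j) (slot-exclusive a b j a≢b (trans (≡.sym (grown-at-v a j)) e))
  ... | ends-at-v refl   =
    trans (grown-at-v′ b i) (slot-exclusive a b i a≢b (trans (≡.sym (grown-at-v′ a i)) e))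
  ... | avoids-v i≢v j≢v = trans (grown-away b i j i≢v j≢v)
                             (disjoint F₀ a b i j a≢b (trans (≡.sym (grown-away a i j i≢v j≢v)) e))

  -- v is a leaf of every grown forest
  grown-acyclic : ∀ a → IsForest (grown a)
  grown-acyclic a = leaf-extension v (grown-sym a) (grown-away a)
    (λ y z ey ez → slot-leaf a y z (trans (≡.sym (grown-at-v a y)) ey) (trans (≡.sym (grown-at-v a z)) ez))
    (acyclic F₀ a)

  attached : DisjointForests k h
  attached = record { forest = grown ; fsym = grown-sym ; acyclic = grown-acyclic
                    ; inside = grown-inside ; disjoint = grown-disjoint }

  attached-away : ∀ a i j → i ≢ v → j ≢ v → forest attached a i j ≡ forest F₀ a i j
  attached-away = grown-away

  attached-star : ∀ j → N j ≡ true → ∃ λ a → forest attached a v j ≡ true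
  attached-star j Nj with slot-exists Nj
  ... | a , sa = a , trans (grown-at-v a j) sa

within : ∀ {n} → VSet n → EdgeSet n
within S i j = S i ∧ S j

within-sym : ∀ {n} (S : VSet n) → Symmetric (within S)
within-sym S i j = ∧-comm (S i) (S j)

degree : ∀ {n} → Graph n → VSet n → Fin n → ℕ
degree G U v = count (induced G U v)

_-_ : ∀ {n} → VSet n → Fin n → VSet n
(U - v) u = U u ∧ not (does (u ≟ v))

delete-self : ∀ {n} (U : VSet n) v → (U - v) v ≡ false
delete-self U v rewrite dec-true (v ≟ v) refl = ∧-zeroʳ (U v)

delete-other : ∀ {n} (U : VSet n) {u v} → u ≢ v → (U - v) u ≡ U u
delete-other U {u} {v} u≢v rewrite dec-false (u ≟ v) u≢v = ∧-identityʳ (U u)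

delete-⊆ : ∀ {n} (U : VSet n) v → (U - v) ⊆ᵥ U
delete-⊆ U v u = ∧-conicalˡ (U u) _

⊆-delete : ∀ {n} {S U : VSet n} {v} → S ⊆ᵥ U → S v ≡ false → S ⊆ᵥ (U - v)
⊆-delete {S = S} {U} {v} S⊆U Sv u Su =
  trans (delete-other U (λ { refl → true≢false (trans (≡.sym Su) Sv) })) (S⊆U u Su)

module _ {n : ℕ} (G : Graph n) where

  induced-sym : ∀ U → Symmetric (induced G U)
  induced-sym U i j = begin
    U i ∧ (U j ∧ adj G i j) ≡⟨ ∧-assoc (U i) (U j) (adj G i j) ⟨
    (U i ∧ U j) ∧ adj G i j ≡⟨ cong₂ _∧_ (∧-comm (U i) (U j)) (sym G i j) ⟩
    (U j ∧ U i) ∧ adj G j i ≡⟨ ∧-assoc (U j) (U i) (adj G j i) ⟩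
    U j ∧ (U i ∧ adj G j i) ∎
    where open ≡-Reasoning

  induced-loopless : ∀ U v → induced G U v v ≡ false
  induced-loopless U v rewrite irrefl G v | ∧-zeroʳ (U v) = ∧-zeroʳ (U v)

  induced-within : ∀ U → induced G U ⊆ₑ within U
  induced-within U i j e = ∧-intro (∧-conicalˡ (U i) _ e) (∧-conicalˡ (U j) _ (∧-conicalʳ (U i) _ e))

  induced-mono : ∀ {T U} → T ⊆ᵥ U → induced G T ⊆ₑ induced G U
  induced-mono {T} {U} T⊆U i j e = ∧-intro (T⊆U i (∧-conicalˡ (T i) _ e))
    (∧-intro (T⊆U j (∧-conicalˡ (T j) _ e′)) (∧-conicalʳ (T j) _ e′))
    where
    e′ : T j ∧ adj G i j ≡ true
    e′ = ∧-conicalʳ (T i) _ e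

  adj∩within⊆induced : ∀ U → adj G ∩ within U ⊆ₑ induced G U
  adj∩within⊆induced U i j e =
    ∧-intro (∧-conicalˡ (U i) _ w) (∧-intro (∧-conicalʳ (U i) _ w) (∧-conicalˡ _ _ e))
    where
    w : within U i j ≡ true
    w = ∧-conicalʳ (adj G i j) _ e

  induced-delete-self : ∀ U v j → induced G (U - v) v j ≡ false
  induced-delete-self U v j = cong (_∧ ((U - v) j ∧ adj G v j)) (delete-self U v)

  induced-delete-other : ∀ U {v i j} → i ≢ v → j ≢ v → induced G (U - v) i j ≡ induced G U i j
  induced-delete-other U {i = i} {j} i≢v j≢v =
    cong₂ (λ x y → x ∧ (y ∧ adj G i j)) (delete-other U i≢v) (delete-other U j≢v)

  minDeg-at? : ∀ κ U v → Dec (U v ≡ true → κ ≤ degree G U v)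
  minDeg-at? κ U v = (U v ≟ᵇ true) →-dec (κ ≤? degree G U v)

  minDeg? : ∀ κ U → Dec (MinDegInduced κ G U)
  minDeg? κ U = all? (minDeg-at? κ U)

  low-degree-vertex : ∀ {κ U} → ¬ MinDegInduced κ G U → ∃ λ v → U v ≡ true × degree G U v < κ
  low-degree-vertex {κ} {U} ¬minDeg with ¬∀⟶∃¬ n _ (minDeg-at? κ U) ¬minDeg
  ... | v , ¬ok = v , Uv , ≰⇒> (λ κ≤ → ¬ok (λ _ → κ≤))
    where
    Uv : U v ≡ true
    Uv = decidable-stable (U v ≟ᵇ true) (λ ¬Uv → ¬ok (λ Uv → contradiction Uv ¬Uv))

  outside-minDeg : ∀ {κ S U v} → MinDegInduced κ G S → S ⊆ᵥ U → degree G U v < κ → S v ≡ false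
  outside-minDeg {v = v} S-minDeg S⊆U deg<κ = ¬-not λ Sv →
    <-irrefl refl (≤-trans deg<κ (≤-trans (S-minDeg v Sv) (count-mono (induced-mono S⊆U v))))

module Peeling {n k : ℕ} (G : Graph n) (S : VSet n) (core : IsCore (suc k) G S)
               (FS : DisjointForests k (induced G S)) where

  record Extension (U : VSet n) : Set where
    field
      family : DisjointForests k (induced G U)
      agrees : ∀ a i j → within S i j ≡ true → forest family a i j ≡ forest FS a i j
      covers : ∀ i j → induced G U i j ≡ true → within S i j ≡ false →
               ∃ λ a → forest family a i j ≡ true

  -- if U ⊇ S has minimum degree k+1 then U ⊆ S by maximality, and FS itself works
  extend-core : ∀ U → S ⊆ᵥ U → MinDegInduced (suc k) G U → Extension U
  extend-core U S⊆U U-minDeg = record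
    { family = weaken (induced-mono G S⊆U) FS
    ; agrees = λ _ _ _ _ → refl
    ; covers = λ i j e outside → contradiction (trans (≡.sym (U⊆within i j e)) outside) true≢false }
    where
    U⊆within : induced G U ⊆ₑ within S
    U⊆within i j e = induced-within G S i j (induced-mono G (proj₂ core U U-minDeg) i j e)

  extend-vertex : ∀ U v → degree G U v ≤ k → S v ≡ false → Extension (U - v) → Extension U
  extend-vertex U v deg≤k Sv E₀ = record { family = attached ; agrees = agrees′ ; covers = covers′ }
    where
    open Extension E₀ renaming (family to F₀; agrees to agrees₀; covers to covers₀)
    open Attach F₀ v (induced G U v) deg≤k (induced-loopless G U v) (induced-delete-self G U v)
                (induced-mono G (delete-⊆ U v)) (λ _ e → e) (induced-sym G U)

    S-avoids-v : ∀ {i} → S i ≡ true → i ≢ v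
    S-avoids-v Si refl = true≢false (trans (≡.sym Si) Sv)

    agrees′ : ∀ a i j → within S i j ≡ true → forest attached a i j ≡ forest FS a i j
    agrees′ a i j w =
      trans (attached-away a i j (S-avoids-v (∧-conicalˡ _ _ w)) (S-avoids-v (∧-conicalʳ _ _ w)))
            (agrees₀ a i j w)

    covers′ : ∀ i j → induced G U i j ≡ true → within S i j ≡ false →
      ∃ λ a → forest attached a i j ≡ true
    covers′ i j e outside with position i j
    ... | starts-at-v refl = attached-star j e
    ... | ends-at-v refl with attached-star i (trans (induced-sym G U v i) e)
    ...   | a , fa = a , trans (fsym attached a i v) fa
    covers′ i j e outside | avoids-v i≢v j≢v
      with covers₀ i j (trans (induced-delete-other G U i≢v j≢v) e) outside
    ...   | a , fa = a , trans (attached-away a i j i≢v j≢v) fa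

  excess : VSet n → ℕ
  excess U = count (λ u → U u ∧ not (S u))

  excess-delete : ∀ U v → U v ≡ true → S v ≡ false → excess (U - v) < excess U
  excess-delete U v Uv Sv = count-mono-< shrink v
    (cong (_∧ not (S v)) (delete-self U v)) (∧-intro Uv (cong not Sv))
    where
    shrink : ∀ u → (U - v) u ∧ not (S u) ≡ true → U u ∧ not (S u) ≡ true
    shrink u e = ∧-intro (delete-⊆ U v u (∧-conicalˡ _ _ e)) (∧-conicalʳ _ _ e)

  extend : ∀ U → S ⊆ᵥ U → Extension U
  extend = All.wfRec (On.wellFounded excess <-wellFounded) 0ℓ (λ U → S ⊆ᵥ U → Extension U) step
    where
    step : ∀ U → (∀ {U′} → excess U′ < excess U → S ⊆ᵥ U′ → Extension U′) →
      S ⊆ᵥ U → Extension U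
    step U extend-smaller S⊆U with minDeg? G (suc k) U
    ... | yes U-minDeg = extend-core U S⊆U U-minDeg
    ... | no ¬minDeg with low-degree-vertex G ¬minDeg
    ...   | v , Uv , deg<k+1 =
      extend-vertex U v (s≤s⁻¹ deg<k+1) Sv (extend-smaller (excess-delete U v Uv Sv) (⊆-delete S⊆U Sv))
      where
      Sv : S v ≡ false
      Sv = outside-minDeg G (proj₁ core) S⊆U deg<k+1

forests-upper-bound : ∀ {n k s} (G : Graph n) (S : VSet n) →
  (∀ (F : DisjointForests k (induced G S)) → totalEdges F ≤ s) →
  (F : DisjointForests k (adj G)) → totalEdges F ≤ numEdges (outsideEdges G S) + s
forests-upper-bound {k = k} {s} G S s-max F = begin
  totalEdges F
    ≡⟨ totalEdges-split F (within S) (within-sym S) ⟩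
  totalEdges inner + totalEdges outer
    ≤⟨ +-mono-≤ (s-max (weaken (adj∩within⊆induced G S) inner)) (totalEdges-≤ outer) ⟩
  s + numEdges (outsideEdges G S)
    ≡⟨ +-comm s _ ⟩
  numEdges (outsideEdges G S) + s
    ∎
  where
  open ≤-Reasoning
  inner : DisjointForests k (adj G ∩ within S)
  inner = restrict F (within S) (within-sym S)
  outer : DisjointForests k (adj G ∩ ∁ (within S))
  outer = restrict F (∁ (within S)) (∁-sym (within-sym S))

forests-lower-bound : ∀ {n k} (G : Graph n) (S : VSet n) → IsCore (suc k) G S →
  (FS : DisjointForests k (induced G S)) →
  Σ (DisjointForests k (adj G)) λ F → totalEdges F ≡ numEdges (outsideEdges G S) + totalEdges FS
forests-lower-bound {k = k} G S core FS = family , counted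
  where
  open Peeling G S core FS
  open Extension (extend (λ _ → true) (λ _ _ → refl))
  inner : DisjointForests k (adj G ∩ within S)
  inner = restrict family (within S) (within-sym S)
  outer : DisjointForests k (adj G ∩ ∁ (within S))
  outer = restrict family (∁ (within S)) (∁-sym (within-sym S))

  FS-inside : ∀ a i j → within S i j ≡ false → forest FS a i j ≡ false
  FS-inside a i j outside =
    ¬-not (λ e → true≢false (trans (≡.sym (induced-within G S i j (inside FS a i j e))) outside))

  inner-is-FS : ∀ a i j → forest family a i j ∧ within S i j ≡ forest FS a i j
  inner-is-FS a i j with within S i j in w
  ... | true  = trans (∧-identityʳ _) (agrees a i j w)
  ... | false = trans (∧-zeroʳ _) (≡.sym (FS-inside a i j w))

  outer-covered : ∀ i j → adj G i j ∧ not (within S i j) ≡ true →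
    ∃ λ a → forest family a i j ∧ not (within S i j) ≡ true
  outer-covered i j e with covers i j (∧-conicalˡ _ _ e) (not-true (∧-conicalʳ _ _ e))
  ... | a , fa = a , ∧-intro fa (∧-conicalʳ _ _ e)

  counted : totalEdges family ≡ numEdges (outsideEdges G S) + totalEdges FS
  counted = begin
    totalEdges family                           ≡⟨ totalEdges-split family (within S) (within-sym S) ⟩
    totalEdges inner + totalEdges outer         ≡⟨ cong₂ _+_ (totalEdges-cong inner FS inner-is-FS)
                                                             (totalEdges-≡ outer outer-covered) ⟩
    totalEdges FS + numEdges (outsideEdges G S) ≡⟨ +-comm (totalEdges FS) _ ⟩
    numEdges (outsideEdges G S) + totalEdges FS ∎
    where open ≡-Reasoning

-- The theorem: for the (k+1)-core S of G, r_k(G) = |E_k(G)| + r_k(G[S]).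
lemma2 : (k : ℕ) → 2 ≤ k → (n : ℕ) → (G : Graph n) → (S : VSet n) →
    IsCore (suc k) G S → (r s : ℕ) →
    IsRank k (adj G) r → IsRank k (induced G S) s →
    r ≡ numEdges (outsideEdges G S) + s
lemma2 k _ n G S core r s ((F , |F|≡r) , r-max) ((FS , |FS|≡s) , s-max) = ≤-antisym upper lower
  where
  upper : r ≤ numEdges (outsideEdges G S) + s
  upper = subst (_≤ numEdges (outsideEdges G S) + s) |F|≡r (forests-upper-bound G S s-max F)

  lower : numEdges (outsideEdges G S) + s ≤ r
  lower with forests-lower-bound G S core FS
  ... | F′ , |F′|≡ =
    subst (_≤ r) (trans |F′|≡ (cong (numEdges (outsideEdges G S) +_) |FS|≡s)) (r-max F′)
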